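{- Let $G$ be a bi-block graph and let $H=K_{m,n}$ be a leaf block of $G$ attached to the rest of $G$ at the cut-vertex $v$. Let $G-H$ denote the graph obtained from $G$ by deleting the vertices of $H$ other than $v$. If $m\geq n$, then $\alpha(G)$ equals either $\alpha(G-H)+m$ or $\alpha(G-H)+m-1$.
   Context: All graphs are finite, simple and connected. A block is a maximal connected subgraph without a cut-vertex; a leaf block is a block whose deletion does not disconnect the graph (here: a block $H$ meeting the rest of $G$ only in the cut-vertex $v$). A bi-block graph is a connected graph each of whose blocks is a complete bipartite graph. $\alpha(\cdot)$ denotes the independence number. -}

module Defs where

open import Data.Nat using (ℕ; _≤_)
open import Data.Fin using (Fin)
open import Data.Fin.Subset using (Subset; _∈_; _∉_; _⊆_; ∁; ⁅_⁆; _─_; ∣_∣)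
open import Data.Bool using (Bool; true; false)
open import Data.Product using (Σ; _×_; ∃; ∃-syntax)
open import Data.Sum using (_⊎_)
open import Relation.Binary.PropositionalEquality using (_≡_; _≢_)
open import Relation.Nullary using (¬_)

record Graph (N : ℕ) : Set where
  field
    adj    : Fin N → Fin N → Bool
    sym    : ∀ x y → adj x y ≡ adj y x
    irrefl : ∀ x → adj x x ≡ false

module _ {N : ℕ} (G : Graph N) where
  open Graph G

  Edge : Fin N → Fin N → Set
  Edge x y = adj x y ≡ true

  data Walk (S : Subset N) : Fin N → Fin N → Set where
    here : ∀ {x} → x ∈ S → Walk S x x
    step : ∀ {x y z} → x ∈ S → Edge x y → Walk S y z → Walk S x z

  ConnectedOn : Subset N → Set
  ConnectedOn S = (∃[ x ] x ∈ S) × (∀ x y → x ∈ S → y ∈ S → Walk S x y)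

  Connected : Set
  Connected = ConnectedOn Data.Fin.Subset.⊤

  IsCutVertexOn : Subset N → Fin N → Set
  IsCutVertexOn S v = v ∈ S × (∃[ x ] ∃[ y ] (x ∈ S × y ∈ S × x ≢ v × y ≢ v
                                    × ¬ Walk (S ─ ⁅ v ⁆) x y))

  IsCutVertex : Fin N → Set
  IsCutVertex = IsCutVertexOn Data.Fin.Subset.⊤

  NoCutVertexOn : Subset N → Set
  NoCutVertexOn S = ∀ v → ¬ IsCutVertexOn S v

  IsBlock : Subset N → Set
  IsBlock B = ConnectedOn B × NoCutVertexOn B
              × (∀ B′ → B ⊆ B′ → ConnectedOn B′ → NoCutVertexOn B′ → B′ ≡ B)

  IsCompleteBipartiteOn : Subset N → ℕ → ℕ → Set
  IsCompleteBipartiteOn B m n =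
    Σ (Subset N) λ X → Σ (Subset N) λ Y →
      (∀ x → x ∈ B → x ∈ X ⊎ x ∈ Y) × X ⊆ B × Y ⊆ B
      × (∀ x → x ∈ X → x ∉ Y)
      × ∣ X ∣ ≡ m × ∣ Y ∣ ≡ n
      × (∀ x y → x ∈ X → y ∈ Y → Edge x y)
      × (∀ x y → x ∈ X → y ∈ X → ¬ Edge x y)
      × (∀ x y → x ∈ Y → y ∈ Y → ¬ Edge x y)

  IsCompleteBipartite : Subset N → Set
  IsCompleteBipartite B = ∃[ m ] ∃[ n ] IsCompleteBipartiteOn B m n

  BiBlock : Set
  BiBlock = Connected × (∀ B → IsBlock B → IsCompleteBipartite B)

  IsLeafBlockAt : Subset N → Fin N → Set
  IsLeafBlockAt H v = IsBlock H × v ∈ H × IsCutVertex v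
    × (∀ B → IsBlock B → B ≢ H → ∀ x → x ∈ B → x ∈ H → x ≡ v)

  Independent : Subset N → Set
  Independent S = ∀ x y → x ∈ S → y ∈ S → ¬ Edge x y

  IsAlphaOn : Subset N → ℕ → Set
  IsAlphaOn U k = (Σ (Subset N) λ S → S ⊆ U × Independent S × ∣ S ∣ ≡ k)
                × (∀ S → S ⊆ U → Independent S → ∣ S ∣ ≤ k)

  IsAlpha : ℕ → Set
  IsAlpha = IsAlphaOn Data.Fin.Subset.⊤

deleteLeaf : ∀ {N} → Subset N → Fin N → Subset N
deleteLeaf H v = ∁ (H ─ ⁅ v ⁆)

-- Every edge lies in some block, so an edge leaving H - v ends at the cut-vertex v.
-- Hence an independent set of G splits into an independent set of G - H and one of
-- H - v ⊆ K_{m,n}, of sizes at most α(G - H) and max(m, n) = m. Conversely, a maximum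
-- independent set of G - H together with the side of size m of H, with v removed from
-- one of the two, is independent, giving α(G) ≥ α(G - H) + m - 1.
module Submission where

open import Defs
open import Data.Nat using (ℕ; zero; suc; _≤_; _+_; _∸_; _⊔_; z≤n; s≤s; s≤s⁻¹)
open import Data.Nat.Properties
  using (+-suc; +-comm; +-identityʳ; +-mono-≤; +-monoʳ-≤; +-monoˡ-≤; ≤-trans; ≤-antisym; ≤-reflexive;
         m≤m+n; m≤m⊔n; m≤n⊔m; m≥n⇒m⊔n≡m; m≤n⇒m<n∨m≡n; module ≤-Reasoning)
open import Data.Fin using (Fin; _≟_)
open import Data.Fin.Subset
  using (Subset; inside; outside; _∈_; _∉_; _⊆_; _⊃_; ∁; ⁅_⁆; _─_; _-_; _∪_; _∩_; ∣_∣)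
open import Data.Fin.Subset.Properties
  using (_∈?_; nonempty?; Empty-unique; ∣⊥∣≡0; ∣⁅x⁆∣≡1; x∈⁅x⁆; x∈⁅y⁆⇒x≡y; x∉⁅y⁆⇒x≢y;
         x∈p∧x≢y⇒x∈p-y; p─q⊆p; x∈∁p⇒x∉p; x∉p⇒x∈∁p; x∈p∩q⁺; x∈p∩q⁻; p∩q⊆p; x∈p∪q⁺; x∈p∪q⁻;
         p⊆q⇒∣p∣≤∣q∣; ⊆-refl; ⊆-trans; ⊆-antisym; ⊆⊤)
open import Data.Fin.Subset.Induction using (⊃-wellFounded)
open import Induction.WellFounded using (WfRec; module All)
open import Data.Vec.Base using (_∷_; []; here; there)
open import Data.Product using (_×_; _,_; ∃-syntax; proj₁; proj₂)
open import Data.Sum using (_⊎_; inj₁; inj₂)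
open import Data.Empty using (⊥-elim)
open import Function using (_∘_)
open import Level using (0ℓ)
open import Relation.Nullary using (¬_; yes; no)
open import Relation.Nullary.Decidable using (decidable-stable)
open import Relation.Binary.PropositionalEquality using (_≡_; _≢_; refl; sym; trans; cong; cong₂; subst; module ≡-Reasoning)

private
  variable
    k : ℕ

∣p∪q∣+∣p∩q∣≡∣p∣+∣q∣ : (p q : Subset k) → ∣ p ∪ q ∣ + ∣ p ∩ q ∣ ≡ ∣ p ∣ + ∣ q ∣
∣p∪q∣+∣p∩q∣≡∣p∣+∣q∣ [] [] = refl
∣p∪q∣+∣p∩q∣≡∣p∣+∣q∣ (inside ∷ p) (inside ∷ q) = cong suc (begin
  ∣ p ∪ q ∣ + suc ∣ p ∩ q ∣  ≡⟨ +-suc ∣ p ∪ q ∣ ∣ p ∩ q ∣ ⟩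
  suc (∣ p ∪ q ∣ + ∣ p ∩ q ∣) ≡⟨ cong suc (∣p∪q∣+∣p∩q∣≡∣p∣+∣q∣ p q) ⟩
  suc (∣ p ∣ + ∣ q ∣)         ≡⟨ +-suc ∣ p ∣ ∣ q ∣ ⟨
  ∣ p ∣ + suc ∣ q ∣           ∎)
  where open ≡-Reasoning
∣p∪q∣+∣p∩q∣≡∣p∣+∣q∣ (inside ∷ p) (outside ∷ q) = cong suc (∣p∪q∣+∣p∩q∣≡∣p∣+∣q∣ p q)
∣p∪q∣+∣p∩q∣≡∣p∣+∣q∣ (outside ∷ p) (inside ∷ q) =
  trans (cong suc (∣p∪q∣+∣p∩q∣≡∣p∣+∣q∣ p q)) (sym (+-suc ∣ p ∣ ∣ q ∣))
∣p∪q∣+∣p∩q∣≡∣p∣+∣q∣ (outside ∷ p) (outside ∷ q) = ∣p∪q∣+∣p∩q∣≡∣p∣+∣q∣ p q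

∣p∪q∣≤∣p∣+∣q∣ : (p q : Subset k) → ∣ p ∪ q ∣ ≤ ∣ p ∣ + ∣ q ∣
∣p∪q∣≤∣p∣+∣q∣ p q = ≤-trans (m≤m+n ∣ p ∪ q ∣ ∣ p ∩ q ∣) (≤-reflexive (∣p∪q∣+∣p∩q∣≡∣p∣+∣q∣ p q))

disjoint⇒∣p∪q∣≡∣p∣+∣q∣ : (p q : Subset k) → (∀ {x} → x ∈ p → x ∉ q) → ∣ p ∪ q ∣ ≡ ∣ p ∣ + ∣ q ∣
disjoint⇒∣p∪q∣≡∣p∣+∣q∣ {k} p q disjoint = begin
  ∣ p ∪ q ∣             ≡⟨ +-identityʳ ∣ p ∪ q ∣ ⟨
  ∣ p ∪ q ∣ + 0         ≡⟨ cong (∣ p ∪ q ∣ +_) ∣p∩q∣≡0 ⟨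
  ∣ p ∪ q ∣ + ∣ p ∩ q ∣ ≡⟨ ∣p∪q∣+∣p∩q∣≡∣p∣+∣q∣ p q ⟩
  ∣ p ∣ + ∣ q ∣         ∎
  where
  open ≡-Reasoning
  ∣p∩q∣≡0 : ∣ p ∩ q ∣ ≡ 0
  ∣p∩q∣≡0 = trans (cong ∣_∣ (Empty-unique λ { (x , x∈p∩q) →
    let (x∈p , x∈q) = x∈p∩q⁻ p q x∈p∩q in disjoint x∈p x∈q })) (∣⊥∣≡0 k)

∣p∣≤∣p∩∁q∣+∣p∩q∣ : (p q : Subset k) → ∣ p ∣ ≤ ∣ p ∩ ∁ q ∣ + ∣ p ∩ q ∣
∣p∣≤∣p∩∁q∣+∣p∩q∣ p q = ≤-trans (p⊆q⇒∣p∣≤∣q∣ split) (∣p∪q∣≤∣p∣+∣q∣ (p ∩ ∁ q) (p ∩ q))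
  where
  split : p ⊆ (p ∩ ∁ q) ∪ (p ∩ q)
  split {x} x∈p with x ∈? q
  ... | yes x∈q = x∈p∪q⁺ (inj₂ (x∈p∩q⁺ (x∈p , x∈q)))
  ... | no  x∉q = x∈p∪q⁺ (inj₁ (x∈p∩q⁺ (x∈p , x∉p⇒x∈∁p x∉q)))

∣p∣≤1+∣p-x∣ : (p : Subset k) (x : Fin k) → ∣ p ∣ ≤ suc ∣ p - x ∣
∣p∣≤1+∣p-x∣ p x = begin
  ∣ p ∣                   ≤⟨ p⊆q⇒∣p∣≤∣q∣ split ⟩
  ∣ (p - x) ∪ ⁅ x ⁆ ∣     ≤⟨ ∣p∪q∣≤∣p∣+∣q∣ (p - x) ⁅ x ⁆ ⟩
  ∣ p - x ∣ + ∣ ⁅ x ⁆ ∣   ≡⟨ cong (∣ p - x ∣ +_) (∣⁅x⁆∣≡1 x) ⟩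
  ∣ p - x ∣ + 1           ≡⟨ +-comm ∣ p - x ∣ 1 ⟩
  suc ∣ p - x ∣           ∎
  where
  open ≤-Reasoning
  split : p ⊆ (p - x) ∪ ⁅ x ⁆
  split {y} y∈p with y ≟ x
  ... | yes refl = x∈p∪q⁺ (inj₂ (x∈⁅x⁆ x))
  ... | no  y≢x  = x∈p∪q⁺ (inj₁ (x∈p∧x≢y⇒x∈p-y y∈p y≢x))

x∈p─q⇒x∉q : (p q : Subset k) {x : Fin k} → x ∈ p ─ q → x ∉ q
x∈p─q⇒x∉q (inside ∷ p) (outside ∷ q) here ()
x∈p─q⇒x∉q (_ ∷ p) (_ ∷ q) (there x∈p─q) (there x∈q) =
  x∈p─q⇒x∉q p q x∈p─q x∈q

x∈p-y⇒x≢y : (p : Subset k) {x y : Fin k} → x ∈ p - y → x ≢ y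
x∈p-y⇒x≢y p {y = y} x∈p-y = x∉⁅y⁆⇒x≢y (x∈p─q⇒x∉q p ⁅ y ⁆ x∈p-y)

m≤n∧n≤1+m⇒m≡n∨m≡n∸1 : ∀ {m n} → m ≤ n → n ≤ suc m → m ≡ n ⊎ m ≡ n ∸ 1
m≤n∧n≤1+m⇒m≡n∨m≡n∸1 {n = zero}  m≤0     _         = inj₁ (≤-antisym m≤0 z≤n)
m≤n∧n≤1+m⇒m≡n∨m≡n∸1 {n = suc n} m≤1+n (s≤s n≤m) with m≤n⇒m<n∨m≡n m≤1+n
... | inj₁ m<1+n = inj₂ (≤-antisym (s≤s⁻¹ m<1+n) n≤m)
... | inj₂ m≡1+n = inj₁ m≡1+n

module _ {N : ℕ} (G : Graph N) where
  Edge-sym : ∀ {x y} → Edge G x y → Edge G y x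
  Edge-sym {x} {y} e = trans (Graph.sym G y x) e

  Independent-⊆ : ∀ {S T} → S ⊆ T → Independent G T → Independent G S
  Independent-⊆ S⊆T indT x y x∈S y∈S = indT x y (S⊆T x∈S) (S⊆T y∈S)

  Independent-∪ : ∀ {S T} → Independent G S → Independent G T
    → (∀ x y → x ∈ S → y ∈ T → ¬ Edge G x y) → Independent G (S ∪ T)
  Independent-∪ {S} {T} indS indT noCross x y x∈S∪T y∈S∪T e
    with x∈p∪q⁻ S T x∈S∪T | x∈p∪q⁻ S T y∈S∪T
  ... | inj₁ x∈S | inj₁ y∈S = indS x y x∈S y∈S e
  ... | inj₁ x∈S | inj₂ y∈T = noCross x y x∈S y∈T e
  ... | inj₂ x∈T | inj₁ y∈S = noCross y x y∈S x∈T (Edge-sym e)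
  ... | inj₂ x∈T | inj₂ y∈T = indT x y x∈T y∈T e

  separated-independent⇒∣S∣+∣T∣≤α : ∀ {U S T a} → IsAlpha G a → S ⊆ ∁ U → T ⊆ U
    → Independent G S → Independent G T → (∀ x y → x ∈ S → y ∈ T → ¬ Edge G x y)
    → ∣ S ∣ + ∣ T ∣ ≤ a
  separated-independent⇒∣S∣+∣T∣≤α {U} {S} {T} {a} (_ , maxG) S⊆∁U T⊆U indS indT noCross =
    subst (_≤ a) (disjoint⇒∣p∪q∣≡∣p∣+∣q∣ S T λ x∈S x∈T → x∈∁p⇒x∉p (S⊆∁U x∈S) (T⊆U x∈T))
      (maxG (S ∪ T) ⊆⊤ (Independent-∪ indS indT noCross))

  completeBipartite-∣independent∣≤⊔ : ∀ {B m n S} → IsCompleteBipartiteOn G B m n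
    → S ⊆ B → Independent G S → ∣ S ∣ ≤ m ⊔ n
  completeBipartite-∣independent∣≤⊔ {B} {m} {n} {S}
    (X , Y , cover , _ , _ , _ , ∣X∣≡m , ∣Y∣≡n , complete , _ , _) S⊆B indS
    with nonempty? (S ∩ X)
  ... | yes (x , x∈S∩X) = ≤-trans (p⊆q⇒∣p∣≤∣q∣ S⊆X) (subst (_≤ m ⊔ n) (sym ∣X∣≡m) (m≤m⊔n m n))
    where
    S⊆X : S ⊆ X
    S⊆X {y} y∈S with cover y (S⊆B y∈S)
    ... | inj₁ y∈X = y∈X
    ... | inj₂ y∈Y = let (x∈S , x∈X) = x∈p∩q⁻ S X x∈S∩X in
      ⊥-elim (indS x y x∈S y∈S (complete x y x∈X y∈Y))
  ... | no S∩X-empty = ≤-trans (p⊆q⇒∣p∣≤∣q∣ S⊆Y) (subst (_≤ m ⊔ n) (sym ∣Y∣≡n) (m≤n⊔m m n))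
    where
    S⊆Y : S ⊆ Y
    S⊆Y {y} y∈S with cover y (S⊆B y∈S)
    ... | inj₁ y∈X = ⊥-elim (S∩X-empty (y , x∈p∩q⁺ (y∈S , y∈X)))
    ... | inj₂ y∈Y = y∈Y

  -- Maximality makes the existence of a block only ¬¬-provable; this suffices because
  -- it is only used to refute something, or to conclude a decidable membership.
  extends-to-block : ∀ B → ConnectedOn G B → NoCutVertexOn G B
    → ¬ ¬ (∃[ B* ] B ⊆ B* × IsBlock G B*)
  extends-to-block = All.wfRec ⊃-wellFounded 0ℓ ExtendsToBlock extend
    where
    ExtendsToBlock : Subset N → Set
    ExtendsToBlock B = ConnectedOn G B → NoCutVertexOn G B → ¬ ¬ (∃[ B* ] B ⊆ B* × IsBlock G B*)

    extend : ∀ B → WfRec _⊃_ ExtendsToBlock B → ExtendsToBlock B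
    extend B larger conn noCut noBlock = noBlock (B , ⊆-refl , conn , noCut , maximal)
      where
      maximal : ∀ B′ → B ⊆ B′ → ConnectedOn G B′ → NoCutVertexOn G B′ → B′ ≡ B
      maximal B′ B⊆B′ conn′ noCut′ = ⊆-antisym B′⊆B B⊆B′
        where
        B′⊆B : B′ ⊆ B
        B′⊆B {z} z∈B′ = decidable-stable (z ∈? B) λ z∉B →
          larger (B⊆B′ , z , z∈B′ , z∉B) conn′ noCut′
            λ (B* , B′⊆B* , block) → noBlock (B* , ⊆-trans B⊆B′ B′⊆B* , block)

  module _ {x y : Fin N} (e : Edge G x y) where

    private
      P : Subset N
      P = ⁅ x ⁆ ∪ ⁅ y ⁆

      x∈P : x ∈ P
      x∈P = x∈p∪q⁺ (inj₁ (x∈⁅x⁆ x))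

      y∈P : y ∈ P
      y∈P = x∈p∪q⁺ (inj₂ (x∈⁅x⁆ y))

      ∈P⇒≡ : ∀ {z} → z ∈ P → z ≡ x ⊎ z ≡ y
      ∈P⇒≡ z∈P with x∈p∪q⁻ ⁅ x ⁆ ⁅ y ⁆ z∈P
      ... | inj₁ z∈⁅x⁆ = inj₁ (x∈⁅y⁆⇒x≡y x z∈⁅x⁆)
      ... | inj₂ z∈⁅y⁆ = inj₂ (x∈⁅y⁆⇒x≡y y z∈⁅y⁆)

      walk : ∀ {p q} → p ≡ x ⊎ p ≡ y → q ≡ x ⊎ q ≡ y → Walk G P p q
      walk (inj₁ refl) (inj₁ refl) = here x∈P
      walk (inj₁ refl) (inj₂ refl) = step x∈P e (here y∈P)
      walk (inj₂ refl) (inj₁ refl) = step y∈P (Edge-sym e) (here x∈P)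
      walk (inj₂ refl) (inj₂ refl) = here y∈P

      others-coincide : ∀ {w p q} → w ≡ x ⊎ w ≡ y → p ≡ x ⊎ p ≡ y → q ≡ x ⊎ q ≡ y
        → p ≢ w → q ≢ w → p ≡ q
      others-coincide _           (inj₁ refl) (inj₁ refl) _   _   = refl
      others-coincide _           (inj₂ refl) (inj₂ refl) _   _   = refl
      others-coincide (inj₁ refl) (inj₁ refl) (inj₂ refl) p≢w _   = ⊥-elim (p≢w refl)
      others-coincide (inj₂ refl) (inj₁ refl) (inj₂ refl) _   q≢w = ⊥-elim (q≢w refl)
      others-coincide (inj₁ refl) (inj₂ refl) (inj₁ refl) _   q≢w = ⊥-elim (q≢w refl)
      others-coincide (inj₂ refl) (inj₂ refl) (inj₁ refl) p≢w _   = ⊥-elim (p≢w refl)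

      edge-connected : ConnectedOn G P
      edge-connected = (x , x∈P) , λ p q p∈P q∈P → walk (∈P⇒≡ p∈P) (∈P⇒≡ q∈P)

      edge-noCutVertex : NoCutVertexOn G P
      edge-noCutVertex w (w∈P , p , q , p∈P , q∈P , p≢w , q≢w , ¬walk) =
        ¬walk (subst (Walk G (P - w) p) (others-coincide (∈P⇒≡ w∈P) (∈P⇒≡ p∈P) (∈P⇒≡ q∈P) p≢w q≢w)
                     (here (x∈p∧x≢y⇒x∈p-y p∈P p≢w)))

    edge-in-block : ¬ ¬ (∃[ B ] IsBlock G B × x ∈ B × y ∈ B)
    edge-in-block noBlock = extends-to-block P edge-connected edge-noCutVertex
      λ (B , P⊆B , block) → noBlock (B , block , P⊆B x∈P , P⊆B y∈P)

  module _ {H : Subset N} {v : Fin N} (leaf : IsLeafBlockAt G H v) where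

    leafBlock-neighbour∈ : ∀ {x y} → x ∈ H → x ≢ v → Edge G x y → y ∈ H
    leafBlock-neighbour∈ {x} {y} x∈H x≢v e = decidable-stable (y ∈? H) λ y∉H →
      edge-in-block e λ (B , block , x∈B , y∈B) →
        x≢v (meets-H-only-at-v B block (λ { refl → y∉H y∈B }) x x∈B x∈H)
      where
      meets-H-only-at-v : ∀ B → IsBlock G B → B ≢ H → ∀ z → z ∈ B → z ∈ H → z ≡ v
      meets-H-only-at-v = proj₂ (proj₂ (proj₂ leaf))

    crossing-edge-ends-at-v : ∀ {p q} → p ∈ deleteLeaf H v → q ∈ H - v → Edge G q p → p ≡ v
    crossing-edge-ends-at-v {p} {q} p∈D q∈H-v e = decidable-stable (p ≟ v) λ p≢v →
      x∈∁p⇒x∉p p∈D (x∈p∧x≢y⇒x∈p-y p∈H p≢v)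
      where
      p∈H : p ∈ H
      p∈H = leafBlock-neighbour∈ (p─q⊆p H ⁅ v ⁆ q∈H-v) (x∈p-y⇒x≢y H q∈H-v) e

    α≤α[G-H]+⊔ : ∀ {m n a b} → IsCompleteBipartiteOn G H m n
      → IsAlpha G a → IsAlphaOn G (deleteLeaf H v) b → a ≤ b + (m ⊔ n)
    α≤α[G-H]+⊔ {m} {n} {a} {b} K ((S , _ , indS , ∣S∣≡a) , _) (_ , maxD) = begin
      a                                        ≡⟨ ∣S∣≡a ⟨
      ∣ S ∣                                    ≤⟨ ∣p∣≤∣p∩∁q∣+∣p∩q∣ S (H - v) ⟩
      ∣ S ∩ deleteLeaf H v ∣ + ∣ S ∩ (H - v) ∣ ≤⟨ +-mono-≤ outside-H inside-H ⟩
      b + (m ⊔ n)                              ∎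
      where
      open ≤-Reasoning
      outside-H : ∣ S ∩ deleteLeaf H v ∣ ≤ b
      outside-H = maxD (S ∩ deleteLeaf H v) (λ {x} → proj₂ ∘ x∈p∩q⁻ S _)
                       (Independent-⊆ (p∩q⊆p S _) indS)
      inside-H : ∣ S ∩ (H - v) ∣ ≤ m ⊔ n
      inside-H = completeBipartite-∣independent∣≤⊔ K (λ {x} → p─q⊆p H ⁅ v ⁆ ∘ proj₂ ∘ x∈p∩q⁻ S _)
                   (Independent-⊆ (p∩q⊆p S _) indS)

    -- A maximum independent set T of G - H is extended by the side X of H: by X - v if v ∈ X
    -- (v may lie in T, but X is independent), and by X after dropping v from T if v ∈ Y.
    α[G-H]+m≤1+α : ∀ {m n a b} → IsCompleteBipartiteOn G H m n
      → IsAlpha G a → IsAlphaOn G (deleteLeaf H v) b → b + m ≤ suc a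
    α[G-H]+m≤1+α {m} {n} {a} {b} (X , Y , cover , X⊆H , _ , X∩Y≡∅ , ∣X∣≡m , _ , _ , indX , _)
      αG ((T , T⊆D , indT , ∣T∣≡b) , _) with cover v (proj₁ (proj₂ leaf))
    ... | inj₁ v∈X = begin
      b + m                       ≡⟨ cong₂ _+_ ∣T∣≡b ∣X∣≡m ⟨
      ∣ T ∣ + ∣ X ∣               ≤⟨ +-monoʳ-≤ ∣ T ∣ (∣p∣≤1+∣p-x∣ X v) ⟩
      ∣ T ∣ + suc ∣ X - v ∣       ≡⟨ +-suc ∣ T ∣ ∣ X - v ∣ ⟩
      suc (∣ T ∣ + ∣ X - v ∣)     ≤⟨ s≤s (separated-independent⇒∣S∣+∣T∣≤α αG T⊆D X-v⊆H-v
                                        indT (Independent-⊆ (p─q⊆p X ⁅ v ⁆) indX) cross) ⟩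
      suc a                       ∎
      where
      open ≤-Reasoning
      X-v⊆H-v : X - v ⊆ H - v
      X-v⊆H-v q∈X-v = x∈p∧x≢y⇒x∈p-y (X⊆H (p─q⊆p X ⁅ v ⁆ q∈X-v)) (x∈p-y⇒x≢y X q∈X-v)
      cross : ∀ p q → p ∈ T → q ∈ X - v → ¬ Edge G p q
      cross p q p∈T q∈X-v e with crossing-edge-ends-at-v (T⊆D p∈T) (X-v⊆H-v q∈X-v) (Edge-sym e)
      ... | refl = indX p q v∈X (p─q⊆p X ⁅ v ⁆ q∈X-v) e
    ... | inj₂ v∈Y = begin
      b + m                       ≡⟨ cong₂ _+_ ∣T∣≡b ∣X∣≡m ⟨
      ∣ T ∣ + ∣ X ∣               ≤⟨ +-monoˡ-≤ ∣ X ∣ (∣p∣≤1+∣p-x∣ T v) ⟩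
      suc (∣ T - v ∣ + ∣ X ∣)     ≤⟨ s≤s (separated-independent⇒∣S∣+∣T∣≤α αG (T⊆D ∘ p─q⊆p T ⁅ v ⁆) X⊆H-v
                                        (Independent-⊆ (p─q⊆p T ⁅ v ⁆) indT) indX cross) ⟩
      suc a                       ∎
      where
      open ≤-Reasoning
      X⊆H-v : X ⊆ H - v
      X⊆H-v {x} x∈X = x∈p∧x≢y⇒x∈p-y (X⊆H x∈X) λ { refl → X∩Y≡∅ x x∈X v∈Y }
      cross : ∀ p q → p ∈ T - v → q ∈ X → ¬ Edge G p q
      cross p q p∈T-v q∈X e =
        x∈p-y⇒x≢y T p∈T-v (crossing-edge-ends-at-v (T⊆D (p─q⊆p T ⁅ v ⁆ p∈T-v)) (X⊆H-v q∈X) (Edge-sym e))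

proposition2p3 : ∀ {N} (G : Graph N) (H : Subset N) (v : Fin N) (m n : ℕ)
    → BiBlock G → IsLeafBlockAt G H v → IsCompleteBipartiteOn G H m n → n ≤ m
    → ∀ a b → IsAlpha G a → IsAlphaOn G (deleteLeaf H v) b
    → a ≡ b + m ⊎ a ≡ b + m ∸ 1
proposition2p3 G H v m n _ leaf K n≤m a b αG αD =
  m≤n∧n≤1+m⇒m≡n∨m≡n∸1
    (subst (λ k → a ≤ b + k) (m≥n⇒m⊔n≡m n≤m) (α≤α[G-H]+⊔ G leaf K αG αD))
    (α[G-H]+m≤1+α G leaf K αG αD)
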